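{- For any circulant scheme $\mathcal X$ of degree $n$ there exists a base $m$-tuple for $\mathcal X$ with $m\le\Omega(n)+1$, where $\Omega(n)$ is the total number of prime divisors of $n$ counted with multiplicity.
   Context: A circulant scheme over a finite cyclic group $G$ is a coherent configuration $(G,S)$ (a partition $S$ of $G\times G$ into basis relations such that the diagonal is a union of basis relations, $S$ is closed under transposition, and the numbers $|\{\gamma:(\alpha,\gamma)\in r,(\gamma,\beta)\in s\}|$ are independent of $(\alpha,\beta)\in t$) such that $(\alpha,\beta)\in s$ implies $(\alpha g,\beta g)\in s$ for all basis relations $s$ and $g\in G$; its degree is $|G|$. A subgroup $H\le G$ is an $\mathcal X$-group if the partition of $G$ into cosets of $H$ is a union of basis relations. $\mathrm{Sec}_1(\mathcal X)$ is the set of quotients $\mathfrak S=U/L$ with $L\le U$ both $\mathcal X$-groups; $U(\mathfrak S)=U$, $L(\mathfrak S)=L$. For $g\in G$, $g_{\mathfrak S}=gL$ if $g\in U$ and $g_{\mathfrak S}=\varnothing$ otherwise. For a tuple $x=(x_1,\dots,x_m)$ put $\Omega(x)=\{x_1,\dots,x_m\}$. An $m$-tuple $x$ of elements of $G$ is a base tuple for $\mathcal X$ if $1_G\in\Omega(x)$ and for each section $\mathfrak S\in\mathrm{Sec}_1(\mathcal X)$ of prime power order there exists $g\in\Omega(x)$ with $g\in U(\mathfrak S)$ and $\mathfrak S=\langle g_{\mathfrak S}\rangle$. -}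

module Defs where

open import Level using (0ℓ)
open import Data.Nat using (ℕ; zero; suc; _+_; _*_; _^_; _≤_; NonZero)
open import Data.Nat.DivMod using (_mod_)
open import Data.Nat.Primality using (Prime)
open import Data.Nat.Primality.Factorisation using (factorise; factors)
open import Data.Fin using (Fin; toℕ; _≟_)
open import Data.Fin.Subset using (Subset; _∈_; _⊆_; ∣_∣)
open import Data.List using (List; length; filter; allFin)
open import Data.Product using (Σ; ∃; ∃-syntax; _×_; _,_)
open import Function.Bundles using (_⇔_)
open import Relation.Nullary.Decidable using (_×-dec_)
open import Relation.Binary.PropositionalEquality using (_≡_)

-- The cyclic group G = ℤ/nℤ, realised on Fin n; its identity 1_G is the residue 0.
module _ (n : ℕ) .{{_ : NonZero n}} where

  infixl 6 _⊕_
  _⊕_ : Fin n → Fin n → Fin n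
  a ⊕ b = (toℕ a + toℕ b) mod n

  e : Fin n
  e = 0 mod n

  _·_ : ℕ → Fin n → Fin n
  j · g = (j * toℕ g) mod n

  -- A partition S of G×G into basis relations, given as a colouring with k colours:
  -- (α,β) and (γ,δ) lie in the same basis relation iff they get the same colour.
  count : {k : ℕ} → (Fin n → Fin n → Fin k) → Fin k → Fin k → Fin n → Fin n → ℕ
  count c r s α β = length (filter (λ γ → (c α γ ≟ r) ×-dec (c γ β ≟ s)) (allFin n))

  record IsCirculantScheme {k : ℕ} (c : Fin n → Fin n → Fin k) : Set where
    field
      -- the diagonal is a union of basis relations
      diagonal : ∀ α γ δ → c α α ≡ c γ δ → γ ≡ δ
      transpose : ∀ α β γ δ → c α β ≡ c γ δ → c β α ≡ c δ γ
      intersection : ∀ r s α β α′ β′ → c α β ≡ c α′ β′ →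
                     count c r s α β ≡ count c r s α′ β′
      invariant : ∀ α β g → c (α ⊕ g) (β ⊕ g) ≡ c α β

  record IsSubgroup (H : Subset n) : Set where
    field
      has-e : e ∈ H
      closed : ∀ {a b} → a ∈ H → b ∈ H → (a ⊕ b) ∈ H
      inverse : ∀ {a} → a ∈ H → ∃[ b ] (b ∈ H × a ⊕ b ≡ e)

  SameCoset : Subset n → Fin n → Fin n → Set
  SameCoset H α β = ∃[ h ] (h ∈ H × β ≡ α ⊕ h)

  -- H is an 𝒳-group: the coset partition relation is a union of basis relations
  IsXGroup : {k : ℕ} → (Fin n → Fin n → Fin k) → Subset n → Set
  IsXGroup c H = IsSubgroup H ×
    (∀ α β γ δ → c α β ≡ c γ δ → (SameCoset H α β ⇔ SameCoset H γ δ))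

  PrimePowerOrder : Subset n → Subset n → Set
  PrimePowerOrder U L = ∃[ p ] ∃[ t ] (Prime p × ∣ U ∣ ≡ p ^ t * ∣ L ∣)

  Generates : Subset n → Subset n → Fin n → Set
  Generates U L g = ∀ {u} → u ∈ U → ∃[ j ] ∃[ l ] (l ∈ L × u ≡ (j · g) ⊕ l)

  InTuple : {m : ℕ} → Fin n → (Fin m → Fin n) → Set
  InTuple g x = ∃[ i ] (x i ≡ g)

  IsBaseTuple : {k m : ℕ} → (Fin n → Fin n → Fin k) → (Fin m → Fin n) → Set
  IsBaseTuple c x =
    InTuple e x ×
    (∀ U L → IsXGroup c U → IsXGroup c L → L ⊆ U → PrimePowerOrder U L →
       ∃[ g ] (InTuple g x × g ∈ U × Generates U L g))

bigΩ : (n : ℕ) → .{{_ : NonZero n}} → ℕ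
bigΩ n = length (factors (factorise n))

-- Every subgroup H of ℤ/n is the set of multiples of a divisor d of n, and |H| d = n. For a section
-- U/L of order pᵗ this forces d_L = pᵗ d_U. Writing |U| = pᵃ s with p ∤ s, the element s d_U = n / pᵃ
-- generates U modulo L, since s is invertible modulo pᵗ; here a ≥ 1 unless t = 0, when 1_G does.
-- Hence 1_G together with the elements n / pᵃ (p prime, 1 ≤ a, pᵃ ∣ n), of which there are Ω(n),
-- form a base tuple.

module Submission where

open import Defs
open import Data.Nat using (ℕ; suc; _+_; _≤_; NonZero)
open import Data.Fin using (Fin)
open import Data.Product using (Σ; ∃-syntax; _×_)

open import Data.Bool using (true; false)
open import Data.Empty using (⊥-elim)
open import Data.Fin using (toℕ) renaming (zero to fzero; suc to fsuc)
open import Data.Fin.Properties using (toℕ-injective; toℕ-fromℕ<; toℕ<n)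
open import Data.Fin.Subset using (Subset; _∈_; ∣_∣)
open import Data.Fin.Subset.Properties using (drop-there; _∈?_)
open import Data.List using (List; []; _∷_; length; map; lookup)
open import Data.List.Membership.Propositional using () renaming (_∈_ to _∈ˡ_)
open import Data.List.Membership.Propositional.Properties using (∈-map⁺)
open import Data.List.Properties using (length-map)
open import Data.List.Relation.Unary.All using (All; []; _∷_)
open import Data.List.Relation.Unary.Any using (here; there; index)
open import Data.List.Relation.Unary.Any.Properties using (lookup-index)
open import Data.Nat using (zero; _*_; _^_; _<_; pred; z≤n; s≤s; s≤s⁻¹)
open import Data.Nat using (≢-nonZero; ≢-nonZero⁻¹; nonTrivial⇒n>1; nonTrivial⇒≢1)
open import Data.Nat.Coprimality as Coprime using (Coprime; coprime-Bézout; coprime-divisor)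
open import Data.Nat.Divisibility
open import Data.Nat.DivMod
  using (_mod_; _%_; _/_; m%n<n; m<n⇒m%n≡m; m%n%n≡m%n; m≡m%n+[m/n]*n; m*n/n≡m; /-congˡ)
  using (%-distribˡ-+; %-distribˡ-*; %-remove-+ʳ)
open import Data.Nat.GCD using (module Bézout)
open import Data.Nat.Induction using (<-wellFounded)
open import Data.Nat.ListAction using (product)
open import Data.Nat.Primality using (Prime; prime⇒irreducible; prime⇒nonTrivial; prime⇒nonZero)
open import Data.Nat.Primality.Factorisation using (factorise; factors; PrimeFactorisation)
open import Data.Nat.Properties
open import Data.Nat.Tactic.RingSolver using (solve-∀)
open import Data.Product using (_,_; proj₁; proj₂)
open import Data.Sum using (inj₁; inj₂)
open import Data.Vec using ([]; _∷_; here; there)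
open import Function using (_∘_)
open import Function.Bundles using (_⇔_; mk⇔; Equivalence)
open import Induction.WellFounded using (Acc; acc)
open import Level using (Level)
open import Relation.Binary.PropositionalEquality
  using (_≡_; refl; sym; trans; cong; cong₂; subst; module ≡-Reasoning)
open import Relation.Nullary using (yes; no; does; ¬_)
open import Relation.Unary using (Pred; Decidable)

private
  variable
    ℓ : Level
    m p q s : ℕ
    P Q : Pred ℕ ℓ

minimal : {P : Pred ℕ ℓ} → Decidable P → P m → ∃[ k ] (P k × (∀ {j} → j < k → ¬ P j))
minimal {m = zero}  P? P0 = 0 , P0 , λ ()
minimal {m = suc m} P? Pm with P? 0
... | yes P0 = 0 , P0 , λ ()
... | no ¬P0 with minimal (P? ∘ suc) Pm
...   | k , Pk , below-k = suc k , Pk , λ { {zero} _ → ¬P0 ; {suc j} j<k → below-k (s≤s⁻¹ j<k) }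

prime∣prime⇒≡ : Prime p → Prime q → q ∣ p → q ≡ p
prime∣prime⇒≡ p-prime q-prime q∣p with prime⇒irreducible p-prime q∣p
... | inj₂ q≡p = q≡p
... | inj₁ q≡1  = ⊥-elim (nonTrivial⇒≢1 {{prime⇒nonTrivial q-prime}} q≡1)

∤⇒coprime : Prime p → ¬ p ∣ s → Coprime s p
∤⇒coprime p-prime p∤s (d∣s , d∣p) with prime⇒irreducible p-prime d∣p
... | inj₁ d≡1 = d≡1
... | inj₂ refl = ⊥-elim (p∤s d∣s)

coprime-^ : Coprime s q → ∀ t → Coprime s (q ^ t)
coprime-^ s⊥q zero    (_ , d∣1)      = ∣1⇒≡1 d∣1
coprime-^ {q = q} s⊥q (suc t) (d∣s , d∣q*qᵗ) = coprime-^ s⊥q t (d∣s , coprime-divisor d⊥q d∣q*qᵗ)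
  where
  d⊥q : Coprime _ q
  d⊥q (e∣d , e∣q) = s⊥q (∣-trans e∣d d∣s , e∣q)

-- j s ≡ i (mod q), stated without subtraction.
coprime⇒congruence-solvable : Coprime s q → ∀ i → ∃[ j ] ∃[ c ] ∃[ b ] (j * s + c * q ≡ i + b * q)
coprime⇒congruence-solvable {s} {q} s⊥q i with coprime-Bézout s⊥q
... | Bézout.+- x y 1+yq≡xs = x * i , 0 , y * i , (begin
  x * i * s + 0 * q ≡⟨ rearrange x i s q ⟩
  i * (x * s)       ≡⟨ cong (i *_) 1+yq≡xs ⟨
  i * (1 + y * q)   ≡⟨ expand i y q ⟩
  i + y * i * q     ∎)
  where
  open ≡-Reasoning
  rearrange : ∀ x i s q → x * i * s + 0 * q ≡ i * (x * s)
  rearrange = solve-∀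
  expand : ∀ i y q → i * (1 + y * q) ≡ i + y * i * q
  expand = solve-∀
... | Bézout.-+ x y 1+xs≡yq with q
...   | zero = ⊥-elim (1+n≢0 (trans 1+xs≡yq (*-zeroʳ y)))
...   | suc q′ = x * q′ * i , i , i * y * q′ , (begin
  x * q′ * i * s + i * suc q′ ≡⟨ rearrange x q′ i s ⟩
  i + i * q′ * (1 + x * s)    ≡⟨ cong (λ z → i + i * q′ * z) 1+xs≡yq ⟩
  i + i * q′ * (y * suc q′)   ≡⟨ rearrange′ i q′ y ⟩
  i + i * y * q′ * suc q′     ∎)
  where
  open ≡-Reasoning
  rearrange : ∀ x q′ i s → x * q′ * i * s + i * suc q′ ≡ i + i * q′ * (1 + x * s)
  rearrange = solve-∀
  rearrange′ : ∀ i q′ y → i + i * q′ * (y * suc q′) ≡ i + i * y * q′ * suc q′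
  rearrange′ = solve-∀

congruence-*ʳ : ∀ {j c i b} d → j * s + c * q ≡ i + b * q →
                j * (s * d) + c * (q * d) ≡ i * d + b * (q * d)
congruence-*ʳ {s} {q} {j} {c} {i} {b} d eq = begin
  j * (s * d) + c * (q * d) ≡⟨ distrib j s c q d ⟩
  (j * s + c * q) * d       ≡⟨ cong (_* d) eq ⟩
  (i + b * q) * d           ≡⟨ distrib′ i b q d ⟩
  i * d + b * (q * d)       ∎
  where
  open ≡-Reasoning
  distrib : ∀ j s c q d → j * (s * d) + c * (q * d) ≡ (j * s + c * q) * d
  distrib = solve-∀
  distrib′ : ∀ i b q d → (i + b * q) * d ≡ i * d + b * (q * d)
  distrib′ = solve-∀

p∣pᵃs⇒1≤a : ∀ {a} → p ∣ p ^ a * s → ¬ p ∣ s → 1 ≤ a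
p∣pᵃs⇒1≤a {s = s} {a = zero} p∣s+0 p∤s = ⊥-elim (p∤s (subst (_ ∣_) (+-identityʳ s) p∣s+0))
p∣pᵃs⇒1≤a {a = suc _} _     _   = s≤s z≤n

p-part : Prime p → ∀ w .{{_ : NonZero w}} → ∃[ a ] ∃[ s ] (w ≡ p ^ a * s × ¬ p ∣ s)
p-part {p} p-prime w = go w (<-wellFounded w)
  where
  instance _ = prime⇒nonTrivial p-prime
  go : ∀ w .{{_ : NonZero w}} → Acc _<_ w → ∃[ a ] ∃[ s ] (w ≡ p ^ a * s × ¬ p ∣ s)
  go w (acc rec) with p ∣? w
  ... | no p∤w = 0 , w , sym (+-identityʳ w) , p∤w
  ... | yes (divides w′ w≡w′p) with go w′ {{w′≢0}} (rec w′<w)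
    where
    w′≢0 : NonZero w′
    w′≢0 = ≢-nonZero λ { refl → ≢-nonZero⁻¹ w w≡w′p }
    w′<w : w′ < w
    w′<w = subst (w′ <_) (sym w≡w′p) (m<m*n w′ p {{w′≢0}} (nonTrivial⇒n>1 p))
  ...   | a , s , w′≡pᵃs , p∤s =
    suc a , s , trans w≡w′p (trans (cong (_* p) w′≡pᵃs) (rearrange (p ^ a) s p)) , p∤s
    where
    rearrange : ∀ x s p → x * s * p ≡ p * x * s
    rearrange = solve-∀

countBelow : {P : Pred ℕ ℓ} → Decidable P → ℕ → ℕ
countBelow P? zero    = 0
countBelow P? (suc m) with does (P? 0)
... | true  = suc (countBelow (P? ∘ suc) m)
... | false = countBelow (P? ∘ suc) m

countBelow-+ : (P? : Decidable P) → ∀ m {n} →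
               countBelow P? (m + n) ≡ countBelow P? m + countBelow (P? ∘ (m +_)) n
countBelow-+ P? zero    = refl
countBelow-+ P? (suc m) with P? 0
... | yes _ = cong suc (countBelow-+ (P? ∘ suc) m)
... | no  _ = countBelow-+ (P? ∘ suc) m

countBelow-none : (P? : Decidable P) → (∀ {k} → k < m → ¬ P k) → countBelow P? m ≡ 0
countBelow-none {m = zero}  P? none = refl
countBelow-none {m = suc m} P? none with P? 0
... | yes P0 = ⊥-elim (none (s≤s z≤n) P0)
... | no  _  = countBelow-none (P? ∘ suc) (none ∘ s≤s)

countBelow-cong : (P? : Decidable P) (Q? : Decidable Q) → (∀ k → P k ⇔ Q k) →
                  ∀ m → countBelow P? m ≡ countBelow Q? m
countBelow-cong P? Q? P⇔Q zero = refl
countBelow-cong P? Q? P⇔Q (suc m) with P? 0 | Q? 0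
... | yes _  | yes _  = cong suc (countBelow-cong (P? ∘ suc) (Q? ∘ suc) (P⇔Q ∘ suc) m)
... | no  _  | no  _  = countBelow-cong (P? ∘ suc) (Q? ∘ suc) (P⇔Q ∘ suc) m
... | yes P0 | no ¬Q0 = ⊥-elim (¬Q0 (Equivalence.to (P⇔Q 0) P0))
... | no ¬P0 | yes Q0 = ⊥-elim (¬P0 (Equivalence.from (P⇔Q 0) Q0))

drop-∈⇔ : ∀ b (S : Subset m) → (∀ i → i ∈ b ∷ S ⇔ P (toℕ i)) → ∀ i → i ∈ S ⇔ P (suc (toℕ i))
drop-∈⇔ _ _ S⇔P i =
  mk⇔ (Equivalence.to (S⇔P (fsuc i)) ∘ there) (drop-there ∘ Equivalence.from (S⇔P (fsuc i)))

∣∣≡countBelow : (P? : Decidable P) (S : Subset m) → (∀ i → i ∈ S ⇔ P (toℕ i)) →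
                ∣ S ∣ ≡ countBelow P? m
∣∣≡countBelow P? [] _ = refl
∣∣≡countBelow {P = P} P? (true ∷ S) S⇔P with P? 0
... | yes _  = cong suc (∣∣≡countBelow (P? ∘ suc) S (drop-∈⇔ {P = P} true S S⇔P))
... | no ¬P0 = ⊥-elim (¬P0 (Equivalence.to (S⇔P fzero) here))
∣∣≡countBelow {P = P} P? (false ∷ S) S⇔P with P? 0
... | no _   = ∣∣≡countBelow (P? ∘ suc) S (drop-∈⇔ {P = P} false S S⇔P)
... | yes P0 with Equivalence.from (S⇔P fzero) P0
...   | ()

countBelow-one-period : ∀ d .{{_ : NonZero d}} → countBelow (d ∣?_) d ≡ 1
countBelow-one-period d@(suc d′) with d ∣? 0
... | yes _    =
  cong suc (countBelow-none ((d ∣?_) ∘ suc) (λ k<d′ d∣1+k → <⇒≱ k<d′ (s≤s⁻¹ (∣⇒≤ d∣1+k))))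
... | no ¬d∣0 = ⊥-elim (¬d∣0 (d ∣0))

countBelow-multiples : ∀ d .{{_ : NonZero d}} w → countBelow (d ∣?_) (w * d) ≡ w
countBelow-multiples d zero    = refl
countBelow-multiples d (suc w) = begin
  countBelow (d ∣?_) (d + w * d)                                ≡⟨ countBelow-+ (d ∣?_) d ⟩
  countBelow (d ∣?_) d + countBelow ((d ∣?_) ∘ (d +_)) (w * d) ≡⟨ cong₂ _+_ (countBelow-one-period d) shift ⟩
  1 + countBelow (d ∣?_) (w * d)                                ≡⟨ cong suc (countBelow-multiples d w) ⟩
  suc w                                                         ∎
  where
  open ≡-Reasoning
  shift : countBelow ((d ∣?_) ∘ (d +_)) (w * d) ≡ countBelow (d ∣?_) (w * d)
  shift = countBelow-cong ((d ∣?_) ∘ (d +_)) (d ∣?_) d∣d+k⇔d∣k (w * d)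
    where
    d∣d+k⇔d∣k : ∀ k → (d ∣ d + k) ⇔ (d ∣ k)
    d∣d+k⇔d∣k k = mk⇔ (λ d∣d+k → ∣m+n∣m⇒∣n d∣d+k ∣-refl) (∣m∣n⇒∣m+n ∣-refl)

multiplicity : ℕ → List ℕ → ℕ
multiplicity p []       = 0
multiplicity p (q ∷ qs) with p ≟ q
... | yes _ = suc (multiplicity p qs)
... | no  _ = multiplicity p qs

-- For each prime p of multiplicity k in qs this lists p ^ k, p ^ (k - 1), …, p ^ 1.
primePowerDivisors : List ℕ → List ℕ
primePowerDivisors []       = []
primePowerDivisors (q ∷ qs) = q ^ suc (multiplicity q qs) ∷ primePowerDivisors qs

length-primePowerDivisors : ∀ qs → length (primePowerDivisors qs) ≡ length qs
length-primePowerDivisors []       = refl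
length-primePowerDivisors (q ∷ qs) = cong suc (length-primePowerDivisors qs)

^∈primePowerDivisors : ∀ {a} qs → 1 ≤ a → a ≤ multiplicity p qs → p ^ a ∈ˡ primePowerDivisors qs
^∈primePowerDivisors []       (s≤s _) ()
^∈primePowerDivisors {p} (q ∷ qs) 1≤a a≤k with p ≟ q
... | no  _    = there (^∈primePowerDivisors qs 1≤a a≤k)
... | yes refl with m≤n⇒m<n∨m≡n a≤k
...   | inj₁ a<1+k = there (^∈primePowerDivisors qs 1≤a (s≤s⁻¹ a<1+k))
...   | inj₂ refl  = here refl

^∣product⇒≤multiplicity : ∀ {a qs} → Prime p → All Prime qs → p ^ a ∣ product qs →
                          a ≤ multiplicity p qs
^∣product⇒≤multiplicity {a = zero} _ _ _ = z≤n
^∣product⇒≤multiplicity {p} {suc a} p-prime [] pᵃ⁺¹∣1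
  with m^n≡1⇒n≡0∨m≡1 p (suc a) (∣1⇒≡1 pᵃ⁺¹∣1)
... | inj₂ p≡1 = ⊥-elim (nonTrivial⇒≢1 {{prime⇒nonTrivial p-prime}} p≡1)
^∣product⇒≤multiplicity {p} {suc a} {q ∷ qs} p-prime (q-prime ∷ qs-prime) pᵃ⁺¹∣qΠ with p ≟ q
... | yes refl = s≤s (^∣product⇒≤multiplicity p-prime qs-prime (*-cancelˡ-∣ p pᵃ⁺¹∣qΠ))
  where instance _ = prime⇒nonZero p-prime
... | no  p≢q  = ^∣product⇒≤multiplicity p-prime qs-prime (coprime-divisor pᵃ⁺¹⊥q pᵃ⁺¹∣qΠ)
  where
  q∤p : ¬ q ∣ p
  q∤p = p≢q ∘ sym ∘ prime∣prime⇒≡ p-prime q-prime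
  pᵃ⁺¹⊥q : Coprime (p ^ suc a) q
  pᵃ⁺¹⊥q = Coprime.sym (coprime-^ (Coprime.sym (∤⇒coprime q-prime q∤p)) (suc a))

module Cyclic (n : ℕ) .{{_ : NonZero n}} where

  [_] : ℕ → Fin n
  [ a ] = a mod n

  toℕ-[] : ∀ a → toℕ [ a ] ≡ a % n
  toℕ-[] a = toℕ-fromℕ< (m%n<n a n)

  []-≡ : ∀ {a b} → a % n ≡ b % n → [ a ] ≡ [ b ]
  []-≡ {a} {b} a≡b = toℕ-injective (trans (toℕ-[] a) (trans a≡b (sym (toℕ-[] b))))

  [toℕ] : ∀ x → [ toℕ x ] ≡ x
  [toℕ] x = toℕ-injective (trans (toℕ-[] (toℕ x)) (m<n⇒m%n≡m (toℕ<n x)))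

  [+n*k] : ∀ a k → [ a + n * k ] ≡ [ a ]
  [+n*k] a k = []-≡ (%-remove-+ʳ a (m∣m*n k))

  [n]≡e : [ n ] ≡ e n
  [n]≡e = trans (cong [_] (sym (*-identityʳ n))) ([+n*k] 0 1)

  -- pred n copies of m act as − m, which avoids subtraction.
  [+m+pred*m] : ∀ a m → [ a + m + pred n * m ] ≡ [ a ]
  [+m+pred*m] a m = trans (cong [_] (trans (+-assoc a m _) (cong (λ k → a + k * m) (suc-pred n)))) ([+n*k] a m)

  ⊕-[] : ∀ a b → _⊕_ n [ a ] [ b ] ≡ [ a + b ]
  ⊕-[] a b =
    []-≡ (trans (cong₂ (λ x y → (x + y) % n) (toℕ-[] a) (toℕ-[] b)) (sym (%-distribˡ-+ a b n)))

  ·-[] : ∀ j a → _·_ n j [ a ] ≡ [ j * a ]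
  ·-[] j a = []-≡ (begin
    j * toℕ [ a ] % n         ≡⟨ cong (λ x → j * x % n) (toℕ-[] a) ⟩
    j * (a % n) % n           ≡⟨ %-distribˡ-* j (a % n) n ⟩
    j % n * (a % n % n) % n   ≡⟨ cong (λ x → j % n * x % n) (m%n%n≡m%n a n) ⟩
    j % n * (a % n) % n       ≡⟨ %-distribˡ-* j a n ⟨
    j * a % n                 ∎)
    where open ≡-Reasoning

  congruent⇒⊕-multiple : ∀ {a b c d k} → a + c * d ≡ b + k * d →
                         ∃[ l ] (d ∣ l × [ b ] ≡ _⊕_ n [ a ] [ l ])
  congruent⇒⊕-multiple {a} {b} {c} {d} {k} a+cd≡b+kd =
    l , ∣m∣n⇒∣m+n (n∣m*n c) (∣n⇒∣m*n (pred n) (n∣m*n k)) , (begin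
      [ b ]                              ≡⟨ [+m+pred*m] b (k * d) ⟨
      [ b + k * d + pred n * (k * d) ]   ≡⟨ cong (λ x → [ x + pred n * (k * d) ]) a+cd≡b+kd ⟨
      [ a + c * d + pred n * (k * d) ]   ≡⟨ cong [_] (+-assoc a (c * d) _) ⟩
      [ a + l ]                          ≡⟨ ⊕-[] a l ⟨
      _⊕_ n [ a ] [ l ]                  ∎)
    where
    open ≡-Reasoning
    l = c * d + pred n * (k * d)

  nonZero-factorˡ : ∀ {a b} → n ≡ a * b → NonZero a
  nonZero-factorˡ n≡ab = ≢-nonZero λ { refl → ≢-nonZero⁻¹ n n≡ab }

  nonZero-factorʳ : ∀ {a b} → n ≡ a * b → NonZero b
  nonZero-factorʳ {a} n≡ab = ≢-nonZero λ { refl → ≢-nonZero⁻¹ n (trans n≡ab (*-zeroʳ a)) }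

  record MultiplesOf (d : ℕ) (H : Subset n) : Set where
    field
      divides-n : d ∣ n
      ∈⇔∣       : ∀ x → x ∈ H ⇔ d ∣ toℕ x

  open MultiplesOf

  ∣⇒[]∈ : ∀ {d H a} → MultiplesOf d H → d ∣ a → [ a ] ∈ H
  ∣⇒[]∈ {d} {H} {a} H=⟨d⟩ d∣a =
    Equivalence.from (∈⇔∣ H=⟨d⟩ [ a ])
      (subst (d ∣_) (sym (toℕ-[] a)) (%-presˡ-∣ d∣a (divides-n H=⟨d⟩)))

  ∣∣*d≡n : ∀ {d H} → MultiplesOf d H → ∣ H ∣ * d ≡ n
  ∣∣*d≡n {d} {H} H=⟨d⟩ with divides-n H=⟨d⟩
  ... | divides w n≡wd = begin
    ∣ H ∣ * d                      ≡⟨ cong (_* d) (∣∣≡countBelow (d ∣?_) H (∈⇔∣ H=⟨d⟩)) ⟩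
    countBelow (d ∣?_) n * d       ≡⟨ cong (λ m → countBelow (d ∣?_) m * d) n≡wd ⟩
    countBelow (d ∣?_) (w * d) * d ≡⟨ cong (_* d) (countBelow-multiples d {{nonZero-factorʳ {w} n≡wd}} w) ⟩
    w * d                          ≡⟨ n≡wd ⟨
    n                              ∎
    where open ≡-Reasoning

  module _ {H : Subset n} (H≤G : IsSubgroup n H) where
    open IsSubgroup H≤G

    [+]-closed : ∀ {a b} → [ a ] ∈ H → [ b ] ∈ H → [ a + b ] ∈ H
    [+]-closed {a} {b} a∈H b∈H = subst (_∈ H) (⊕-[] a b) (closed a∈H b∈H)

    [*]-closed : ∀ {a} j → [ a ] ∈ H → [ j * a ] ∈ H
    [*]-closed zero    _   = has-e
    [*]-closed (suc j) a∈H = [+]-closed a∈H ([*]-closed j a∈H)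

    -- H is generated by [ d ] for the least positive d with [ d ] ∈ H (d = n if H is trivial);
    -- the remainder of any N with [ N ] ∈ H modulo d is again in H, hence 0.
    subgroup⇒multiples : ∃[ d ] MultiplesOf d H
    subgroup⇒multiples =
      d , record { divides-n = ∈⇒∣ n [n]∈H ; ∈⇔∣ = λ x → mk⇔ (x∈H⇒d∣x x) (d∣x⇒x∈H x) }
      where
      [n]∈H : [ n ] ∈ H
      [n]∈H = subst (_∈ H) (sym [n]≡e) has-e
      least : ∃[ k ] ([ suc k ] ∈ H × (∀ {j} → j < k → ¬ [ suc j ] ∈ H))
      least = minimal (λ k → [ suc k ] ∈? H) (subst (λ k → [ k ] ∈ H) (sym (suc-pred n)) [n]∈H)
      d = suc (proj₁ least)
      [d]∈H : [ d ] ∈ H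
      [d]∈H = proj₁ (proj₂ least)
      below-d : ∀ {j} → j < d → [ j ] ∈ H → j ≡ 0
      below-d {zero}  _   _     = refl
      below-d {suc j} j<d [j]∈H = ⊥-elim (proj₂ (proj₂ least) (s≤s⁻¹ j<d) [j]∈H)
      ∈⇒∣ : ∀ N → [ N ] ∈ H → d ∣ N
      ∈⇒∣ N [N]∈H = m%n≡0⇒n∣m N d (below-d (m%n<n N d) [r]∈H)
        where
        r = N % d
        k = N / d
        shift : [ N + pred n * (k * d) ] ≡ [ r ]
        shift = trans (cong (λ x → [ x + pred n * (k * d) ]) (m≡m%n+[m/n]*n N d)) ([+m+pred*m] r (k * d))
        [r]∈H : [ r ] ∈ H
        [r]∈H = subst (_∈ H) shift ([+]-closed [N]∈H ([*]-closed (pred n) ([*]-closed k [d]∈H)))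
      x∈H⇒d∣x : ∀ x → x ∈ H → d ∣ toℕ x
      x∈H⇒d∣x x x∈H = ∈⇒∣ (toℕ x) (subst (_∈ H) (sym ([toℕ] x)) x∈H)
      d∣x⇒x∈H : ∀ x → d ∣ toℕ x → x ∈ H
      d∣x⇒x∈H x (divides q x≡qd) =
        subst (_∈ H) (trans (cong [_] (sym x≡qd)) ([toℕ] x)) ([*]-closed q [d]∈H)

  ∣U∣≡q∣L∣⇒dL≡q*dU : ∀ {dU dL U L q} → MultiplesOf dU U → MultiplesOf dL L →
                     ∣ U ∣ ≡ q * ∣ L ∣ → dL ≡ q * dU
  ∣U∣≡q∣L∣⇒dL≡q*dU {dU} {dL} {U} {L} {q} U=⟨dU⟩ L=⟨dL⟩ ∣U∣≡q∣L∣ =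
    *-cancelˡ-≡ dL (q * dU) ∣ L ∣ {{∣L∣≢0}} (begin
    ∣ L ∣ * dL       ≡⟨ ∣∣*d≡n L=⟨dL⟩ ⟩
    n                ≡⟨ ∣∣*d≡n U=⟨dU⟩ ⟨
    ∣ U ∣ * dU       ≡⟨ cong (_* dU) ∣U∣≡q∣L∣ ⟩
    q * ∣ L ∣ * dU   ≡⟨ cong (_* dU) (*-comm q ∣ L ∣) ⟩
    ∣ L ∣ * q * dU   ≡⟨ *-assoc ∣ L ∣ q dU ⟩
    ∣ L ∣ * (q * dU) ∎)
    where
    open ≡-Reasoning
    ∣L∣≢0 = nonZero-factorˡ (sym (∣∣*d≡n L=⟨dL⟩))

  coprime-multiple-generates : ∀ {dU s q U L} → MultiplesOf dU U → MultiplesOf (q * dU) L → Coprime s q →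
                               Generates n U L [ s * dU ]
  coprime-multiple-generates {dU} {s} {q} U=⟨dU⟩ L=⟨qdU⟩ s⊥q {u} u∈U
    with Equivalence.to (∈⇔∣ U=⟨dU⟩ u) u∈U
  ... | divides i u≡i*dU with coprime⇒congruence-solvable s⊥q i
  ... | j , c , b , js+cq≡i+bq with congruent⇒⊕-multiple {j * (s * dU)} {i * dU} {c} {q * dU} {b}
                                   (congruence-*ʳ {s} {q} {j} {c} {i} {b} dU js+cq≡i+bq)
  ... | l , qdU∣l , [idU]≡[jsdU]⊕[l] = j , [ l ] , ∣⇒[]∈ L=⟨qdU⟩ qdU∣l , (begin
    u                               ≡⟨ [toℕ] u ⟨
    [ toℕ u ]                       ≡⟨ cong [_] u≡i*dU ⟩
    [ i * dU ]                      ≡⟨ [idU]≡[jsdU]⊕[l] ⟩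
    _⊕_ n [ j * (s * dU) ] [ l ]    ≡⟨ cong (λ g → _⊕_ n g [ l ]) (·-[] j (s * dU)) ⟨
    _⊕_ n (_·_ n j [ s * dU ]) [ l ] ∎)
    where
    open ≡-Reasoning

  -- Only applied to prime powers, so the zero case is never used.
  cofactor : ℕ → Fin n
  cofactor zero      = e n
  cofactor q@(suc _) = [ n / q ]

  cofactor-≡ : ∀ q .{{_ : NonZero q}} {G} → n ≡ q * G → cofactor q ≡ [ G ]
  cofactor-≡ q@(suc _) {G} n≡qG = cong [_] (trans (/-congˡ (trans n≡qG (*-comm q G))) (m*n/n≡m G q))

  baseList : List (Fin n)
  baseList = e n ∷ map cofactor (primePowerDivisors (factors (factorise n)))

  length-baseList : length baseList ≡ bigΩ n + 1
  length-baseList = trans (cong suc length-tail) (+-comm 1 (bigΩ n))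
    where
    ps = factors (factorise n)
    length-tail = trans (length-map cofactor (primePowerDivisors ps)) (length-primePowerDivisors ps)

  ∈⇒InTuple : ∀ {g xs} → g ∈ˡ xs → InTuple n g (lookup xs)
  ∈⇒InTuple g∈xs = index g∈xs , sym (lookup-index g∈xs)

  cofactor∈baseList : ∀ {a G} → Prime p → 1 ≤ a → n ≡ p ^ a * G → [ G ] ∈ˡ baseList
  cofactor∈baseList {p} {a} {G} p-prime 1≤a n≡pᵃG =
    there (subst (_∈ˡ _) (cofactor-≡ (p ^ a) n≡pᵃG) (∈-map⁺ cofactor pᵃ∈))
    where
    instance
      _ = prime⇒nonZero p-prime
      _ = m^n≢0 p a
    fact = factorise n
    pᵃ∣Π : p ^ a ∣ product (factors fact)
    pᵃ∣Π = divides G (trans (sym (PrimeFactorisation.isFactorisation fact)) (trans n≡pᵃG (*-comm (p ^ a) G)))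
    pᵃ∈ : p ^ a ∈ˡ primePowerDivisors (factors fact)
    pᵃ∈ = ^∈primePowerDivisors _ 1≤a
            (^∣product⇒≤multiplicity p-prime (PrimeFactorisation.factorsPrime fact) pᵃ∣Π)

  prime-power-section-generator : ∀ {U L} → IsSubgroup n U → IsSubgroup n L → PrimePowerOrder n U L →
                                  ∃[ g ] (InTuple n g (lookup baseList) × g ∈ U × Generates n U L g)
  prime-power-section-generator {U} {L} U≤G L≤G (p , t , p-prime , ∣U∣≡pᵗ∣L∣)
    with subgroup⇒multiples U≤G | subgroup⇒multiples L≤G
  ... | dU , U=⟨dU⟩ | dL , L=⟨dL⟩ =
    generator t ∣U∣≡pᵗ∣L∣ (subst (λ d → MultiplesOf d L) dL≡pᵗdU L=⟨dL⟩)
    where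
    dL≡pᵗdU = ∣U∣≡q∣L∣⇒dL≡q*dU {q = p ^ t} U=⟨dU⟩ L=⟨dL⟩ ∣U∣≡pᵗ∣L∣
    ∣U∣≢0 = nonZero-factorˡ (sym (∣∣*d≡n U=⟨dU⟩))
    generator : ∀ t → ∣ U ∣ ≡ p ^ t * ∣ L ∣ → MultiplesOf (p ^ t * dU) L →
                ∃[ g ] (InTuple n g (lookup baseList) × g ∈ U × Generates n U L g)
    -- For t = 0, s = 0 is coprime to p ^ 0 = 1 and [ 0 * dU ] is 1_G.
    generator zero _ L=⟨dU⟩ =
      e n , (fzero , refl) , ∣⇒[]∈ U=⟨dU⟩ (dU ∣0) ,
      coprime-multiple-generates {s = 0} U=⟨dU⟩ L=⟨dU⟩ (λ (_ , d∣1) → ∣1⇒≡1 d∣1)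
    generator (suc t) ∣U∣≡pᵗ⁺¹∣L∣ L=⟨pᵗ⁺¹dU⟩ with p-part p-prime ∣ U ∣ {{∣U∣≢0}}
    ... | a , s , ∣U∣≡pᵃs , p∤s =
      [ s * dU ] , ∈⇒InTuple (cofactor∈baseList p-prime 1≤a n≡pᵃsdU) , ∣⇒[]∈ U=⟨dU⟩ (n∣m*n s) ,
      coprime-multiple-generates U=⟨dU⟩ L=⟨pᵗ⁺¹dU⟩ (coprime-^ (∤⇒coprime p-prime p∤s) (suc t))
      where
      p∣∣U∣ : p ∣ ∣ U ∣
      p∣∣U∣ = subst (p ∣_) (sym ∣U∣≡pᵗ⁺¹∣L∣) (∣-trans (m∣m*n (p ^ t)) (m∣m*n ∣ L ∣))
      1≤a : 1 ≤ a
      1≤a = p∣pᵃs⇒1≤a (subst (p ∣_) ∣U∣≡pᵃs p∣∣U∣) p∤s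
      n≡pᵃsdU : n ≡ p ^ a * (s * dU)
      n≡pᵃsdU = trans (sym (∣∣*d≡n U=⟨dU⟩)) (trans (cong (_* dU) ∣U∣≡pᵃs) (*-assoc (p ^ a) s dU))

lemma6p3 : (n : ℕ) → .{{_ : NonZero n}} → (k : ℕ) → (c : Fin n → Fin n → Fin k) →
           IsCirculantScheme n c →
           ∃[ m ] Σ (Fin m → Fin n) (λ x → m ≤ bigΩ n + 1 × IsBaseTuple n c x)
lemma6p3 n k c _ =
  length baseList , lookup baseList , ≤-reflexive length-baseList , (fzero , refl) ,
  λ U L U-XGroup L-XGroup _ → prime-power-section-generator (proj₁ U-XGroup) (proj₁ L-XGroup)
  where open Cyclic n
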